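{- Let $N=(V,E,\{\tau_{ij}\},\{u_{ij}\})$ be a temporal network with source $s$, sink $d$ and time horizon $T$. Let $\phi$ be a cut function corresponding to a minimum $(s,0)$-$(d,T)$ cut in $\textsc{TEN}(N,T)$, and let $A\subseteq[0,T]$ with $0,T\in A$ satisfy $\mathrm{crit}(\phi)\cap[0,T]\subseteq A$. Then any minimum $(s,0)$-$(d,T)$ cut in $\textsc{cTEN}(N,A,T)$ (viewed, via its cut function, as a cut of $\textsc{TEN}(N,T)$) is also a minimum $(s,0)$-$(d,T)$ cut in $\textsc{TEN}(N,T)$. In particular, the capacity of a minimum $(s,0)$-$(d,T)$ cut in $\textsc{cTEN}(N,A,T)$ equals that of a minimum $(s,0)$-$(d,T)$ cut in $\textsc{TEN}(N,T)$.
   Context: $[a,b]=\{a,a+1,\dots,b\}$. A temporal network has vertex set $V$, directed edges $E$, integer edge lengths $\tau_{ij}$ and capacity functions $u_{ij}:\mathbb{Z}\to\mathbb{R}_{\ge0}$. $\textsc{TEN}(N,T)$ is the steady-state flow network with vertex set $V\times[0,T]$, an edge $(i,t)\to(j,t+\tau_{ij})$ of capacity $u_{ij}(t)$ whenever $ij\in E$, $i\ne j$, $t,t+\tau_{ij}\in[0,T]$ and $u_{ij}(t)\neq0$, and an infinite-capacity edge $(i,t)\to(i,t+1)$ for every $i\in V$, $t\in[0,T-1]$; its source is $(s,0)$ and sink $(d,T)$. For $A=\{t_1<\dots<t_k\}\subseteq[0,T]$ with $t_1=0$, $t_k=T$ (and $t_{k+1}:=T+1$), $\textsc{cTEN}(N,A,T)$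 is obtained from $\textsc{TEN}(N,T)$ by collapsing, for each $v\in V$ and each $i$, all nodes $(v,t)$ with $t\in[t_i,t_{i+1}-1]$ into a single node $(v,t_i)$ (so the vertex set is $V\times A$), with infinite-capacity edges $(x,t_i)\to(x,t_{i+1})$ and, for $xy\in E$, an edge $(x,t_i)\to(y,t_j)$ of capacity $\sum\{u_{xy}(t): t_i\le t<t_{i+1},\ t_j\le t+\tau_{xy}<t_{j+1}\}$ when this is nonzero; source $(s,0)$, sink $(d,T)$. A cut function on $\textsc{TEN}(N,T)$ (resp. $\textsc{cTEN}(N,A,T)$) is a map $\phi:V\to[0,T+1]$ (resp. $V\to A\cup\{T+1\}$) with $\phi(s)=0$, $\phi(d)=T+1$; it represents the $(s,0)$-$(d,T)$ cut whose source side is $\{(i,t): t\ge\phi(i)\}$. Finite-capacity cuts correspond one-to-one with cut functions, and every cut function of $\textsc{cTEN}(N,A,T)$ is also a cut function of $\textsc{TEN}(N,T)$. The capacity (cost) of a cut is the total capacity of edges from the source side to the sink side. $\mathrm{crit}(\phi):=\{t:\exists i\in V,\ \phi(i)=t\}$ is the range of $\phi$. -}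

module Defs where

open import Level using (Level; _⊔_) renaming (suc to lsuc)
open import Data.Bool using (Bool; true; false; if_then_else_; _∧_; not)
open import Data.Nat using (ℕ; zero; suc; _≤_; _<_; _≤ᵇ_; _<ᵇ_)
open import Data.Nat.Properties using (_≟_)
open import Data.Integer using (ℤ; +_) renaming (_+_ to _+ℤ_)
import Data.Integer.Properties as ℤP
open import Data.Fin using (Fin)
import Data.Fin.Properties as FinP
open import Data.List using (List; []; _∷_; upTo; allFin)
open import Data.Product using (_×_)
import Data.Sum
open import Relation.Nullary.Decidable using (⌊_⌋)
open import Relation.Binary.PropositionalEquality using (_≡_; _≢_)
open import Relation.Binary.Structures using (IsTotalOrder)
open import Algebra.Bundles using (CommutativeMonoid)

-- The paper uses capacities in ℝ_{≥0}.  Agda's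
-- library has no reals, so we work over an arbitrary totally ordered
-- commutative monoid whose addition is monotone and whose elements are
-- all ≥ the neutral element 0; (ℝ_{≥0}, +, 0, ≤) is an instance.

record CapacityDomain (c ℓ₁ ℓ₂ : Level) : Set (lsuc (c ⊔ ℓ₁ ⊔ ℓ₂)) where
  field
    cmonoid : CommutativeMonoid c ℓ₁
  open CommutativeMonoid cmonoid public
  field
    _≤C_         : Carrier → Carrier → Set ℓ₂
    isTotalOrder : IsTotalOrder _≈_ _≤C_
    ∙-mono       : ∀ {x y z w} → x ≤C y → z ≤C w → (x ∙ z) ≤C (y ∙ w)
    nonneg       : ∀ x → ε ≤C x

record TemporalNetwork {c ℓ₁ ℓ₂ : Level} (C : CapacityDomain c ℓ₁ ℓ₂) (n : ℕ)
       : Set c where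
  open CapacityDomain C
  field
    E : Fin n → Fin n → Bool
    τ : Fin n → Fin n → ℤ
    u : Fin n → Fin n → ℤ → Carrier
    s : Fin n
    d : Fin n

module _ {c ℓ₁ ℓ₂ : Level} (C : CapacityDomain c ℓ₁ ℓ₂) where
  open CapacityDomain C

  ΣL : {X : Set} → List X → (X → Carrier) → Carrier
  ΣL []       f = ε
  ΣL (x ∷ xs) f = f x ∙ ΣL xs f

  when : Bool → Carrier → Carrier
  when b x = if b then x else ε

  range : ℕ → List ℕ
  range T = upTo (suc T)

  module _ {n : ℕ} (N : TemporalNetwork C n) (T : ℕ) where
    open TemporalNetwork N

    neqV : Fin n → Fin n → Bool
    neqV i j = not ⌊ i FinP.≟ j ⌋

    arrives : Fin n → Fin n → ℕ → ℕ → Bool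
    arrives i j t t' = ⌊ (+ t') ℤP.≟ ((+ t) +ℤ τ i j) ⌋

    -- Capacity of the cut of TEN(N,T) represented by φ (source side
    -- {(i,t) : t ≥ φ i}).  Holdover edges (i,t)→(i,t+1) never leave the
    -- source side, so only transit edges (i,t)→(j,t+τ_ij), i ≠ j, ij ∈ E,
    -- t, t+τ_ij ∈ [0,T], contribute (edges of capacity 0 contribute 0).
    costTEN : (Fin n → ℕ) → Carrier
    costTEN φ =
      ΣL (allFin n) λ i → ΣL (allFin n) λ j →
      ΣL (range T) λ t → ΣL (range T) λ t' →
        when (E i j ∧ neqV i j ∧ arrives i j t t' ∧ (φ i ≤ᵇ t) ∧ (t' <ᵇ φ j))
             (u i j (+ t))

    record IsCutFunTEN (φ : Fin n → ℕ) : Set where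
      field
        bounded : ∀ v → φ v ≤ suc T
        at-s    : φ s ≡ 0
        at-d    : φ d ≡ suc T

    record IsMinCutTEN (φ : Fin n → ℕ) : Set (ℓ₂) where
      field
        isCut   : IsCutFunTEN φ
        minimal : ∀ χ → IsCutFunTEN χ → costTEN φ ≤C costTEN χ

    module _ (A : ℕ → Bool) where
      -- A ⊆ [0,T] is {a ≤ T : A a ≡ true}.
      -- blk t = the t_i ∈ A with t_i ≤ t < t_{i+1}, i.e. max (A ∩ [0,t])
      -- (using 0 ∈ A).
      blk : ℕ → ℕ
      blk zero    = zero
      blk (suc t) = if A (suc t) then suc t else blk t

      -- Capacity of the cTEN edge (x,a)→(y,a'):
      --   Σ { u_xy(t) : a ≤ t < next(a), a' ≤ t+τ_xy < next(a') }.
      capC : Fin n → Fin n → ℕ → ℕ → Carrier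
      capC x y a a' =
        ΣL (range T) λ t → ΣL (range T) λ t' →
          when (arrives x y t t' ∧ ⌊ blk t ≟ a ⌋ ∧ ⌊ blk t' ≟ a' ⌋) (u x y (+ t))

      -- Capacity of the cut of cTEN(N,A,T) represented by ψ
      -- (source side {(v,a) : a ≥ ψ v}); holdover edges never cross.
      costCTEN : (Fin n → ℕ) → Carrier
      costCTEN ψ =
        ΣL (allFin n) λ x → ΣL (allFin n) λ y →
        ΣL (range T) λ a → ΣL (range T) λ a' →
          when (E x y ∧ neqV x y ∧ A a ∧ A a' ∧ (ψ x ≤ᵇ a) ∧ (a' <ᵇ ψ y))
               (capC x y a a')

      record IsCutFunCTEN (ψ : Fin n → ℕ) : Set where
        field
          inRange : ∀ v → (ψ v ≤ T × A (ψ v) ≡ true) Data.Sum.⊎ ψ v ≡ suc T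
          at-s    : ψ s ≡ 0
          at-d    : ψ d ≡ suc T

      record IsMinCutCTEN (ψ : Fin n → ℕ) : Set ℓ₂ where
        field
          isCut   : IsCutFunCTEN ψ
          minimal : ∀ χ → IsCutFunCTEN χ → costCTEN ψ ≤C costCTEN χ

{-# OPTIONS --safe #-}
module Submission where

-- For t ∈ [0,T] let blk t = max (A ∩ [0,t]) be the node of cTEN(N,A,T) into
-- which (v,t) is collapsed. If every value of a cut function ψ lies in
-- A ∪ {T+1}, then ψ v ≤ blk t ⇔ ψ v ≤ t for all t ≤ T, so a TEN edge crosses
-- the cut ψ exactly when the cTEN edge it is merged into does; since every cTEN
-- capacity is the sum of the capacities of the TEN edges merged into it, ψ has
-- the same capacity in both networks. The minimum cut φ of TEN is such a ψ, so
-- a minimum cut of cTEN costs at most φ, hence is a minimum cut of TEN.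

open import Defs
open import Level using (Level)
open import Data.Bool using (Bool; true; false; _∧_)
open import Data.Bool.Properties using (∧-commutativeMonoid)
open import Data.Nat
  using (ℕ; zero; suc; _≤_; _<_; _≤ᵇ_; _<ᵇ_; z≤n; s≤s; s≤s⁻¹; _≤?_; _<?_)
open import Data.Nat.Properties
  using ( _≟_; suc-injective; ≤-refl; ≤-reflexive; ≤-trans; ≤-<-trans; m≤n⇒m≤1+n
        ; m≤n⇒m<n∨m≡n; ≤∧≢⇒<; ≰⇒>; <⇒≱; 1+n≰n)
open import Data.Fin using (Fin)
open import Data.Product using (_×_; _,_)
open import Data.Sum using (_⊎_; inj₁; inj₂)
open import Data.List using (List; []; _∷_; upTo; map; allFin)
open import Data.List.Properties using (map-upTo)
open import Data.List.Membership.Propositional using (_∈_)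
open import Data.List.Membership.Propositional.Properties using (∈-upTo⁻)
open import Data.List.Relation.Unary.Any using (here; there)
open import Data.Integer using (+_)
open import Function using (_∘_; _⇔_; mk⇔; Equivalence)
open import Relation.Nullary.Decidable using (⌊_⌋; isYes≗does; does-⇔)
open import Relation.Binary.PropositionalEquality as ≡ using (_≡_; _≢_)
open import Relation.Nullary using (contradiction)
open import Relation.Binary.Structures using (IsTotalOrder)
import Algebra.Properties.CommutativeSemigroup as CommutativeSemigroupProperties
open import Algebra.Solver.CommutativeMonoid ∧-commutativeMonoid using (solve; _⊜_; _⊕_)

module ΣL-Properties {c ℓ₁ ℓ₂ : Level} (C : CapacityDomain c ℓ₁ ℓ₂) where
  open CapacityDomain C
  open CommutativeSemigroupProperties commutativeSemigroup using (interchange)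

  ΣL-zero : ∀ {X : Set} (xs : List X) → ΣL C xs (λ _ → ε) ≈ ε
  ΣL-zero []       = refl
  ΣL-zero (x ∷ xs) = trans (identityˡ _) (ΣL-zero xs)

  ΣL-cong-∈ : ∀ {X : Set} (xs : List X) {f g : X → Carrier} →
              (∀ {x} → x ∈ xs → f x ≈ g x) → ΣL C xs f ≈ ΣL C xs g
  ΣL-cong-∈ []       f≈g = refl
  ΣL-cong-∈ (x ∷ xs) f≈g = ∙-cong (f≈g (here ≡.refl)) (ΣL-cong-∈ xs (f≈g ∘ there))

  ΣL-cong : ∀ {X : Set} (xs : List X) {f g : X → Carrier} →
            (∀ x → f x ≈ g x) → ΣL C xs f ≈ ΣL C xs g
  ΣL-cong xs f≈g = ΣL-cong-∈ xs (λ {x} _ → f≈g x)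

  ΣL-distrib-∙ : ∀ {X : Set} (xs : List X) (f g : X → Carrier) →
                 ΣL C xs (λ x → f x ∙ g x) ≈ ΣL C xs f ∙ ΣL C xs g
  ΣL-distrib-∙ []       f g = sym (identityˡ ε)
  ΣL-distrib-∙ (x ∷ xs) f g =
    trans (∙-cong refl (ΣL-distrib-∙ xs f g)) (interchange _ _ _ _)

  ΣL-comm : ∀ {X Y : Set} (xs : List X) (ys : List Y) (f : X → Y → Carrier) →
            ΣL C xs (λ x → ΣL C ys (f x)) ≈ ΣL C ys (λ y → ΣL C xs (λ x → f x y))
  ΣL-comm []       ys f = sym (ΣL-zero ys)
  ΣL-comm (x ∷ xs) ys f =
    trans (∙-cong refl (ΣL-comm xs ys f)) (sym (ΣL-distrib-∙ ys _ _))

  ΣL-comm₂ : ∀ {X Y : Set} (xs : List X) (ys : List Y) (f : X → X → Y → Y → Carrier) →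
             ΣL C xs (λ a → ΣL C xs (λ b → ΣL C ys (λ c → ΣL C ys (f a b c))))
             ≈ ΣL C ys (λ c → ΣL C ys (λ d → ΣL C xs (λ a → ΣL C xs (λ b → f a b c d))))
  ΣL-comm₂ xs ys f =
    trans (ΣL-cong xs λ a → ΣL-comm xs ys _)
    (trans (ΣL-comm xs ys _)
    (trans (ΣL-cong ys λ c → ΣL-cong xs λ a → ΣL-comm xs ys _)
           (ΣL-cong ys λ c → ΣL-comm xs ys _)))

  ΣL-map : ∀ {X Y : Set} (h : X → Y) (xs : List X) (f : Y → Carrier) →
           ΣL C (map h xs) f ≡ ΣL C xs (f ∘ h)
  ΣL-map h []       f = ≡.refl
  ΣL-map h (x ∷ xs) f = ≡.cong (f (h x) ∙_) (ΣL-map h xs f)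

  ΣL-upTo-suc : ∀ m (f : ℕ → Carrier) → ΣL C (upTo (suc m)) f ≡ f 0 ∙ ΣL C (upTo m) (f ∘ suc)
  ΣL-upTo-suc m f = ≡.cong (f 0 ∙_)
    (≡.trans (≡.cong (λ xs → ΣL C xs f) (≡.sym (map-upTo suc m))) (ΣL-map suc (upTo m) f))

  when-∧ : ∀ b b′ x → when C (b ∧ b′) x ≡ when C b (when C b′ x)
  when-∧ true  b′ x = ≡.refl
  when-∧ false b′ x = ≡.refl

  when-reorder : ∀ f r p q x →
                 when C f (when C (r ∧ p ∧ q) x) ≡ when C q (when C p (when C (f ∧ r) x))
  when-reorder f r p q x = begin
    when C f (when C (r ∧ p ∧ q) x)         ≡⟨ ≡.sym (when-∧ f _ x) ⟩
    when C (f ∧ r ∧ p ∧ q) x                ≡⟨ ≡.cong (λ b → when C b x) (∧-shuffle f r p q) ⟩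
    when C (q ∧ p ∧ f ∧ r) x                ≡⟨ when-∧ q _ x ⟩
    when C q (when C (p ∧ f ∧ r) x)         ≡⟨ ≡.cong (when C q) (when-∧ p _ x) ⟩
    when C q (when C p (when C (f ∧ r) x))  ∎
    where
    open ≡.≡-Reasoning
    ∧-shuffle : ∀ f r p q → f ∧ r ∧ p ∧ q ≡ q ∧ p ∧ f ∧ r
    ∧-shuffle = solve 4 (λ f r p q → f ⊕ r ⊕ p ⊕ q ⊜ q ⊕ p ⊕ f ⊕ r) ≡.refl

  when-distrib-ΣL : ∀ {X : Set} b (xs : List X) (f : X → Carrier) →
                    when C b (ΣL C xs f) ≈ ΣL C xs (λ x → when C b (f x))
  when-distrib-ΣL true  xs f = refl
  when-distrib-ΣL false xs f = sym (ΣL-zero xs)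

  ΣL-upTo-indicator : ∀ {m k} (f : ℕ → Carrier) → k < m →
                      ΣL C (upTo m) (λ a → when C ⌊ k ≟ a ⌋ (f a)) ≈ f k
  ΣL-upTo-indicator {suc m} {zero} f _ = begin
    ΣL C (upTo (suc m)) (λ a → when C ⌊ 0 ≟ a ⌋ (f a))  ≡⟨ ΣL-upTo-suc m _ ⟩
    f 0 ∙ ΣL C (upTo m) (λ _ → ε)                        ≈⟨ ∙-cong refl (ΣL-zero (upTo m)) ⟩
    f 0 ∙ ε                                              ≈⟨ identityʳ (f 0) ⟩
    f 0                                                  ∎
    where open import Relation.Binary.Reasoning.Setoid setoid
  ΣL-upTo-indicator {suc m} {suc k} f (s≤s k<m) = begin
    ΣL C (upTo (suc m)) (λ a → when C ⌊ suc k ≟ a ⌋ (f a))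
      ≡⟨ ΣL-upTo-suc m _ ⟩
    ε ∙ ΣL C (upTo m) (λ a → when C ⌊ suc k ≟ suc a ⌋ (f (suc a)))
      ≈⟨ identityˡ _ ⟩
    ΣL C (upTo m) (λ a → when C ⌊ suc k ≟ suc a ⌋ (f (suc a)))
      ≈⟨ ΣL-cong (upTo m) (λ a → reflexive (≡.cong (λ b → when C b _) (≟-suc a))) ⟩
    ΣL C (upTo m) (λ a → when C ⌊ k ≟ a ⌋ (f (suc a)))
      ≈⟨ ΣL-upTo-indicator (f ∘ suc) k<m ⟩
    f (suc k) ∎
    where
    open import Relation.Binary.Reasoning.Setoid setoid
    ≟-suc : ∀ a → ⌊ suc k ≟ suc a ⌋ ≡ ⌊ k ≟ a ⌋
    ≟-suc a = ≡.trans (isYes≗does (suc k ≟ suc a))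
      (≡.trans (does-⇔ (mk⇔ suc-injective (≡.cong suc)) (suc k ≟ suc a) (k ≟ a))
               (≡.sym (isYes≗does (k ≟ a))))

InCutRange : ℕ → (ℕ → Bool) → ℕ → Set
InCutRange T A b = (b ≤ T × A b ≡ true) ⊎ b ≡ suc T

module Blocks {c ℓ₁ ℓ₂ : Level} (C : CapacityDomain c ℓ₁ ℓ₂) {n : ℕ}
              (N : TemporalNetwork C n) (T : ℕ) (A : ℕ → Bool) where

  blk-≤ : ∀ t → blk C N T A t ≤ t
  blk-≤ zero    = z≤n
  blk-≤ (suc t) with A (suc t)
  ... | true  = ≤-refl
  ... | false = m≤n⇒m≤1+n (blk-≤ t)

  A-blk : A 0 ≡ true → ∀ t → A (blk C N T A t) ≡ true
  A-blk A0 zero    = A0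
  A-blk A0 (suc t) with A (suc t) in At
  ... | true  = At
  ... | false = A-blk A0 t

  blk-maximal : ∀ {a t} → a ≤ t → A a ≡ true → a ≤ blk C N T A t
  blk-maximal {t = zero}  a≤0   _  = a≤0
  blk-maximal {a} {suc t} a≤1+t Aa with A (suc t) in At
  ... | true  = a≤1+t
  ... | false = blk-maximal (s≤s⁻¹ (≤∧≢⇒< a≤1+t a≢1+t)) Aa
    where
    a≢1+t : a ≢ suc t
    a≢1+t a≡1+t = contradiction (≡.trans (≡.sym Aa) (≡.trans (≡.cong A a≡1+t) At)) λ ()

  ≤-blk⇔≤ : ∀ {b t} → InCutRange T A b → t ≤ T → (b ≤ blk C N T A t ⇔ b ≤ t)
  ≤-blk⇔≤ {b} {t} b∈ t≤T = mk⇔ (λ b≤blk → ≤-trans b≤blk (blk-≤ t)) (from b∈)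
    where
    from : InCutRange T A b → b ≤ t → b ≤ blk C N T A t
    from (inj₁ (_ , Ab)) b≤t = blk-maximal b≤t Ab
    from (inj₂ ≡.refl)   b≤t = contradiction (≤-trans b≤t t≤T) 1+n≰n

  ≤ᵇ-blk : ∀ {b t} → InCutRange T A b → t ≤ T → (b ≤ᵇ blk C N T A t) ≡ (b ≤ᵇ t)
  ≤ᵇ-blk {b} {t} b∈ t≤T = does-⇔ (≤-blk⇔≤ b∈ t≤T) (b ≤? blk C N T A t) (b ≤? t)

  <ᵇ-blk : ∀ {b t} → InCutRange T A b → t ≤ T → (blk C N T A t <ᵇ b) ≡ (t <ᵇ b)
  <ᵇ-blk {b} {t} b∈ t≤T = does-⇔ (mk⇔ to (≤-<-trans (blk-≤ t))) (blk C N T A t <? b) (t <? b)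
    where
    to : blk C N T A t < b → t < b
    to blk<b = ≰⇒> (λ b≤t → <⇒≱ blk<b (Equivalence.from (≤-blk⇔≤ b∈ t≤T) b≤t))

module CollapsedCost {c ℓ₁ ℓ₂ : Level} (C : CapacityDomain c ℓ₁ ℓ₂) {n : ℕ}
                     (N : TemporalNetwork C n) (T : ℕ) (A : ℕ → Bool) (A0 : A 0 ≡ true)
                     (ψ : Fin n → ℕ) (ψ∈ : ∀ v → InCutRange T A (ψ v)) where
  open CapacityDomain C
  open TemporalNetwork N
  open ΣL-Properties C
  open Blocks C N T A
  open import Relation.Binary.Reasoning.Setoid setoid

  private
    R : List ℕ
    R = range C T

    ΣT : (ℕ → Carrier) → Carrier
    ΣT = ΣL C R

    B : ℕ → ℕ
    B = blk C N T A

    ∈range⇒≤ : ∀ {t} → t ∈ range C T → t ≤ T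
    ∈range⇒≤ = s≤s⁻¹ ∘ ∈-upTo⁻

  module _ (x y : Fin n) where
    crossesCTEN : ℕ → ℕ → Bool
    crossesCTEN a a′ = E x y ∧ neqV C N T x y ∧ A a ∧ A a′ ∧ (ψ x ≤ᵇ a) ∧ (a′ <ᵇ ψ y)

    crossesTEN : ℕ → ℕ → Bool
    crossesTEN t t′ = E x y ∧ neqV C N T x y ∧ arrives C N T x y t t′ ∧ (ψ x ≤ᵇ t) ∧ (t′ <ᵇ ψ y)

    crossesCTEN-blk : ∀ {t t′} → t ≤ T → t′ ≤ T →
                      crossesCTEN (B t) (B t′) ∧ arrives C N T x y t t′ ≡ crossesTEN t t′
    crossesCTEN-blk {t} {t′} t≤T t′≤T
      rewrite A-blk A0 t | A-blk A0 t′ | ≤ᵇ-blk (ψ∈ x) t≤T | <ᵇ-blk (ψ∈ y) t′≤T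
      = solve 5 (λ e ne p q r → (e ⊕ ne ⊕ p ⊕ q) ⊕ r ⊜ e ⊕ ne ⊕ r ⊕ p ⊕ q) ≡.refl
          (E x y) (neqV C N T x y) (ψ x ≤ᵇ t) (t′ <ᵇ ψ y) (arrives C N T x y t t′)

    TEN-edge-contribution : ∀ {t t′} → t ≤ T → t′ ≤ T →
      ΣT (λ a → ΣT (λ a′ → when C (crossesCTEN a a′)
        (when C (arrives C N T x y t t′ ∧ ⌊ B t ≟ a ⌋ ∧ ⌊ B t′ ≟ a′ ⌋) (u x y (+ t)))))
      ≈ when C (crossesTEN t t′) (u x y (+ t))
    TEN-edge-contribution {t} {t′} t≤T t′≤T = begin
      ΣT (λ a → ΣT (λ a′ → when C (crossesCTEN a a′) (when C (arr ∧ in-a a ∧ in-a′ a′) cap)))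
        ≈⟨ ΣL-cong R (λ a → ΣL-cong R (λ a′ →
             reflexive (when-reorder (crossesCTEN a a′) arr (in-a a) (in-a′ a′) cap))) ⟩
      ΣT (λ a → ΣT (λ a′ → when C (in-a′ a′) (when C (in-a a) (when C (crossesCTEN a a′ ∧ arr) cap))))
        ≈⟨ ΣL-cong R (λ a → ΣL-upTo-indicator
             (λ a′ → when C (in-a a) (when C (crossesCTEN a a′ ∧ arr) cap)) (blk<1+T t′≤T)) ⟩
      ΣT (λ a → when C (in-a a) (when C (crossesCTEN a (B t′) ∧ arr) cap))
        ≈⟨ ΣL-upTo-indicator (λ a → when C (crossesCTEN a (B t′) ∧ arr) cap) (blk<1+T t≤T) ⟩
      when C (crossesCTEN (B t) (B t′) ∧ arr) cap
        ≡⟨ ≡.cong (λ b → when C b cap) (crossesCTEN-blk t≤T t′≤T) ⟩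
      when C (crossesTEN t t′) cap ∎
      where
      arr : Bool
      arr = arrives C N T x y t t′

      cap : Carrier
      cap = u x y (+ t)

      in-a in-a′ : ℕ → Bool
      in-a  a  = ⌊ B t ≟ a ⌋
      in-a′ a′ = ⌊ B t′ ≟ a′ ⌋

      blk<1+T : ∀ {s} → s ≤ T → B s < suc T
      blk<1+T {s} s≤T = s≤s (≤-trans (blk-≤ s) s≤T)

    edge-cost : ΣT (λ a → ΣT (λ a′ → when C (crossesCTEN a a′) (capC C N T A x y a a′)))
                ≈ ΣT (λ t → ΣT (λ t′ → when C (crossesTEN t t′) (u x y (+ t))))
    edge-cost = begin
      ΣT (λ a → ΣT (λ a′ → when C (crossesCTEN a a′) (ΣT (λ t → ΣT (term a a′ t)))))
        ≈⟨ ΣL-cong R (λ a → ΣL-cong R (λ a′ →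
             trans (when-distrib-ΣL _ R _) (ΣL-cong R (λ t → when-distrib-ΣL _ R _)))) ⟩
      ΣT (λ a → ΣT (λ a′ → ΣT (λ t → ΣT (contribution a a′ t))))
        ≈⟨ ΣL-comm₂ R R contribution ⟩
      ΣT (λ t → ΣT (λ t′ → ΣT (λ a → ΣT (λ a′ → contribution a a′ t t′))))
        ≈⟨ ΣL-cong-∈ R (λ t∈ → ΣL-cong-∈ R (λ t′∈ →
             TEN-edge-contribution (∈range⇒≤ t∈) (∈range⇒≤ t′∈))) ⟩
      ΣT (λ t → ΣT (λ t′ → when C (crossesTEN t t′) (u x y (+ t)))) ∎
      where
      term contribution : ℕ → ℕ → ℕ → ℕ → Carrier
      term a a′ t t′ = when C (arrives C N T x y t t′ ∧ ⌊ B t ≟ a ⌋ ∧ ⌊ B t′ ≟ a′ ⌋) (u x y (+ t))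
      contribution a a′ t t′ = when C (crossesCTEN a a′) (term a a′ t t′)

  costCTEN≈costTEN : costCTEN C N T A ψ ≈ costTEN C N T ψ
  costCTEN≈costTEN = ΣL-cong (allFin n) (λ x → ΣL-cong (allFin n) (edge-cost x))

module _ {c ℓ₁ ℓ₂ : Level} (C : CapacityDomain c ℓ₁ ℓ₂) {n : ℕ}
         (N : TemporalNetwork C n) (T : ℕ) (A : ℕ → Bool) where

  IsCutFunTEN⇒IsCutFunCTEN : ∀ {φ} → (∀ v → φ v ≤ T → A (φ v) ≡ true) →
                             IsCutFunTEN C N T φ → IsCutFunCTEN C N T A φ
  IsCutFunTEN⇒IsCutFunCTEN {φ} A-crit φ-cut = record
    { inRange = inRange ; at-s = IsCutFunTEN.at-s φ-cut ; at-d = IsCutFunTEN.at-d φ-cut }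
    where
    inRange : ∀ v → InCutRange T A (φ v)
    inRange v with m≤n⇒m<n∨m≡n (IsCutFunTEN.bounded φ-cut v)
    ... | inj₁ φv<1+T = inj₁ (s≤s⁻¹ φv<1+T , A-crit v (s≤s⁻¹ φv<1+T))
    ... | inj₂ φv≡1+T = inj₂ φv≡1+T

  IsCutFunCTEN⇒IsCutFunTEN : ∀ {ψ} → IsCutFunCTEN C N T A ψ → IsCutFunTEN C N T ψ
  IsCutFunCTEN⇒IsCutFunTEN {ψ} ψ-cut = record
    { bounded = bounded ; at-s = IsCutFunCTEN.at-s ψ-cut ; at-d = IsCutFunCTEN.at-d ψ-cut }
    where
    bounded : ∀ v → ψ v ≤ suc T
    bounded v with IsCutFunCTEN.inRange ψ-cut v
    ... | inj₁ (ψv≤T , _) = m≤n⇒m≤1+n ψv≤T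
    ... | inj₂ ψv≡1+T     = ≤-reflexive ψv≡1+T

lemma1 : {c ℓ₁ ℓ₂ : Level} (C : CapacityDomain c ℓ₁ ℓ₂) {n : ℕ}
         (N : TemporalNetwork C n) (T : ℕ)
         (φ : Fin n → ℕ) → IsMinCutTEN C N T φ →
         (A : ℕ → Bool) → A 0 ≡ true → A T ≡ true →
         (∀ v → φ v ≤ T → A (φ v) ≡ true) →
         (ψ : Fin n → ℕ) → IsMinCutCTEN C N T A ψ →
         IsMinCutTEN C N T ψ
           × CapacityDomain._≈_ C (costCTEN C N T A ψ) (costTEN C N T φ)
-- T ∈ A only makes the sink (d,T) a node of cTEN; the cost formulas do not need it.
lemma1 C N T φ φ-min A A0 _ A-crit ψ ψ-min = ψ-min′ , trans (costCTEN≈costTEN ψ ψ-range) ψ≈φ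
  where
  open CapacityDomain C
  module ≤C = IsTotalOrder isTotalOrder
  open CollapsedCost C N T A A0 using (costCTEN≈costTEN)

  φ-cut : IsCutFunCTEN C N T A φ
  φ-cut = IsCutFunTEN⇒IsCutFunCTEN C N T A A-crit (IsMinCutTEN.isCut φ-min)

  ψ-cut : IsCutFunTEN C N T ψ
  ψ-cut = IsCutFunCTEN⇒IsCutFunTEN C N T A (IsMinCutCTEN.isCut ψ-min)

  ψ-range : ∀ v → InCutRange T A (ψ v)
  ψ-range = IsCutFunCTEN.inRange (IsMinCutCTEN.isCut ψ-min)

  ψ≤φ : costTEN C N T ψ ≤C costTEN C N T φ
  ψ≤φ = ≤C.trans (≤C.reflexive (sym (costCTEN≈costTEN ψ ψ-range)))
          (≤C.trans (IsMinCutCTEN.minimal ψ-min φ φ-cut)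
                    (≤C.reflexive (costCTEN≈costTEN φ (IsCutFunCTEN.inRange φ-cut))))

  ψ≈φ : costTEN C N T ψ ≈ costTEN C N T φ
  ψ≈φ = ≤C.antisym ψ≤φ (IsMinCutTEN.minimal φ-min ψ ψ-cut)

  ψ-min′ : IsMinCutTEN C N T ψ
  ψ-min′ = record
    { isCut = ψ-cut ; minimal = λ χ χ-cut → ≤C.trans ψ≤φ (IsMinCutTEN.minimal φ-min χ χ-cut) }
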